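{- Let $p\ge 5$ be a prime such that $X^3-X-1$ has three distinct roots $\alpha,\beta,\gamma$ in $\mathbb{F}_p$. Let $(a_n)_{n\in\mathbb{Z}}$ be a complete Padovan sequence in $\mathbb{F}_p$ with initial values $(1,b,c)$, and assume $\gamma^2 b+\gamma c+1=0$, so that $a_n=A\alpha^n+B\beta^n$ for all $n$, where $A=\frac{\alpha^2 b+\alpha c+1}{2\alpha+3}$ and $B=\frac{\beta^2 b+\beta c+1}{2\beta+3}$. Let $N$ be the multiplicative order of $\alpha/\beta$ in $\mathbb{F}_p^*$, for $k\ge 0$ let $I_k=\{j\in\mathbb{Z} : 0\le j\le k,\ \alpha^j\beta^{k-j}=1 \text{ in } \mathbb{F}_p\}$, let $k_{\min}$ be the smallest $k\ge 1$ with $I_k\neq\varnothing$, and let $j_0=\min(I_{k_{\min}})$. If $k_{\min}>\frac{p-1}{N}$, then $k_{\min}<N+j_0$, and therefore $I_{k_{\min}}=\{j_0\}$.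
   Context: A complete Padovan sequence in $\mathbb{F}_p$ is a sequence $(a_n)_{n\in\mathbb{Z}}$ in $\mathbb{F}_p$ with $a_0=1$, $a_{n+3}=a_n+a_{n+1}$ for all $n$, periodic with period $p-1$, and with $\{a_1,\dots,a_{p-2}\}=\{2,\dots,p-1\}$. -}

module Defs where

open import Data.Nat using (ℕ; zero; suc; _+_; _*_; _∸_; _≤_; _<_; NonZero)
open import Data.Nat.DivMod using (_mod_)
open import Data.Fin using (Fin; toℕ)
open import Data.Integer as ℤ using (ℤ; +_)
open import Data.Product using (_×_; ∃; ∃-syntax)
open import Relation.Binary.PropositionalEquality using (_≡_)

module _ (p : ℕ) .{{_ : NonZero p}} where

  [_] : ℕ → Fin p
  [ n ] = n mod p

  _+F_ : Fin p → Fin p → Fin p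
  x +F y = (toℕ x + toℕ y) mod p

  _*F_ : Fin p → Fin p → Fin p
  x *F y = (toℕ x * toℕ y) mod p

  -F_ : Fin p → Fin p
  -F x = (p ∸ toℕ x) mod p

  _-F_ : Fin p → Fin p → Fin p
  x -F y = x +F (-F y)

  _^F_ : Fin p → ℕ → Fin p
  x ^F zero = [ 1 ]
  x ^F suc n = x *F (x ^F n)

  IsRootCubic : Fin p → Set
  IsRootCubic x = ((x ^F 3) -F x) -F [ 1 ] ≡ [ 0 ]

  IsMultOrder : Fin p → ℕ → Set
  IsMultOrder x N = 1 ≤ N × (x ^F N ≡ [ 1 ])
                    × (∀ m → 1 ≤ m → x ^F m ≡ [ 1 ] → N ≤ m)

  CompletePadovan : (ℤ → Fin p) → Set
  CompletePadovan a =
      (a (+ 0) ≡ [ 1 ])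
    × (∀ n → a (n ℤ.+ + 3) ≡ a n +F a (n ℤ.+ + 1))
    × (∀ n → a (n ℤ.+ + (p ∸ 1)) ≡ a n)
    × (∀ i → 1 ≤ i → i ≤ p ∸ 2 → 2 ≤ toℕ (a (+ i)))
    × (∀ (m : Fin p) → 2 ≤ toℕ m → ∃[ i ] (1 ≤ i × i ≤ p ∸ 2 × a (+ i) ≡ m))

  InI : Fin p → Fin p → ℕ → ℕ → Set
  InI α β k j = j ≤ k × ((α ^F j) *F (β ^F (k ∸ j))) ≡ [ 1 ]

  IsKmin : Fin p → Fin p → ℕ → Set
  IsKmin α β kmin = 1 ≤ kmin × (∃[ j ] InI α β kmin j)
                    × (∀ k → 1 ≤ k → ∃[ j ] InI α β k j → kmin ≤ k)

  IsMinI : Fin p → Fin p → ℕ → ℕ → Set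
  IsMinI α β k j0 = InI α β k j0 × (∀ j → InI α β k j → j0 ≤ j)

{-# OPTIONS --safe #-}
module Submission where

-- Write q = α/β, so that α^j β^(k-j) = q^j β^k and I_k = {j ≤ k : q^j β^k = 1}.
-- Suppose N + j0 ≤ kmin. Then there is no relation q^u β^e = 1 with 1 ≤ e < kmin:
-- reducing u mod N, the case u ≤ e contradicts the minimality of kmin, and for u > e,
-- dividing q^(N+j0) β^kmin = 1 by it gives q^(N+j0-u) β^(kmin-e) = 1 with
-- N+j0-u ≤ kmin-e < kmin, contradicting it again. Hence the kmin·N units q^r β^s
-- (r < N, s < kmin) are pairwise distinct nonzero elements of F_p, so kmin·N ≤ p - 1.
-- Finally, once kmin < N + j0, two elements of I_kmin differ by less than N, so they
-- are equal.

open import Defs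
open import Data.Nat using (ℕ; _+_; _*_; _∸_; _≤_; _<_; NonZero)
open import Data.Nat.Primality using (Prime)
open import Data.Fin using (Fin)
open import Data.Integer using (ℤ; +_)
open import Data.Product using (_×_)
open import Relation.Binary.PropositionalEquality using (_≡_; _≢_)

open import Algebra.Bundles using (CommutativeMonoid)
open import Algebra.Structures.Biased using (isCommutativeMonoidˡ)
open import Data.Fin using (toℕ; zero; suc; remQuot; combine)
open import Data.Fin.Properties
  using (toℕ<n; toℕ-injective; toℕ-fromℕ<; combine-remQuot; injective⇒≤)
open import Data.Nat using (zero; suc; z≤n; s≤s; z<s; _≤?_; >-nonZero; >-nonZero⁻¹)
open import Data.Nat.Properties
open import Data.Nat.DivMod
  using (_%_; _/_; _mod_; m≡m%n+[m/n]*n; m%n<n; %-distribˡ-*; m%n%n≡m%n; m<n⇒m%n≡m)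
open import Data.Product using (_,_; proj₁; map; uncurry)
open import Data.Product.Properties using (×-≡,≡→≡)
open import Data.Sum using (inj₁; inj₂)
open import Function using (_∘_)
open import Function.Definitions using (Injective)
open import Level using (0ℓ)
open import Relation.Nullary using (¬_; yes; no; contradiction)
import Relation.Binary.PropositionalEquality as ≡

module CommutativeMonoidPowers {c ℓ} (M : CommutativeMonoid c ℓ) where

  open CommutativeMonoid M
  open import Algebra.Definitions _≈_ using (RightInvertible)
  open import Algebra.Properties.CommutativeSemigroup commutativeSemigroup using (interchange)
  open import Algebra.Properties.Monoid monoid using (cancelˡ)
  open import Algebra.Properties.CommutativeMonoid.Mult M
    using (×-homo-+; ×-distrib-+; ×-assocˡ; ×-congʳ) renaming (_×_ to _×ᴹ_)
  open import Relation.Binary.Reasoning.Setoid setoid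

  -- Powers are stdlib's n × x read multiplicatively, so the ×-lemmas apply to them verbatim.
  infixr 8 _^_
  _^_ : Carrier → ℕ → Carrier
  x ^ n = n ×ᴹ x

  ε^n≈ε : ∀ n → ε ^ n ≈ ε
  ε^n≈ε zero    = refl
  ε^n≈ε (suc n) = trans (identityˡ _) (ε^n≈ε n)

  ^-mod : ∀ {x N} .{{_ : NonZero N}} → x ^ N ≈ ε → ∀ m → x ^ m ≈ x ^ (m % N)
  ^-mod {x} {N} xᴺ≈ε m = begin
    x ^ m                           ≡⟨ ≡.cong (x ^_) (m≡m%n+[m/n]*n m N) ⟩
    x ^ (m % N + m / N * N)         ≈⟨ ×-homo-+ x (m % N) _ ⟩
    x ^ (m % N) ∙ x ^ (m / N * N)   ≈⟨ ∙-congˡ (sym (×-assocˡ x (m / N) N)) ⟩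
    x ^ (m % N) ∙ (x ^ N) ^ (m / N) ≈⟨ ∙-congˡ (×-congʳ (m / N) xᴺ≈ε) ⟩
    x ^ (m % N) ∙ ε ^ (m / N)       ≈⟨ ∙-congˡ (ε^n≈ε (m / N)) ⟩
    x ^ (m % N) ∙ ε                 ≈⟨ identityʳ _ ⟩
    x ^ (m % N)                     ∎

  ^-rebase : ∀ {α β q j k} → q ∙ β ≈ α → j ≤ k → α ^ j ∙ β ^ (k ∸ j) ≈ q ^ j ∙ β ^ k
  ^-rebase {α} {β} {q} {j} {k} qβ≈α j≤k = begin
    α ^ j ∙ β ^ (k ∸ j)           ≈⟨ ∙-congʳ (×-congʳ j (sym qβ≈α)) ⟩
    (q ∙ β) ^ j ∙ β ^ (k ∸ j)     ≈⟨ ∙-congʳ (×-distrib-+ q β j) ⟩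
    (q ^ j ∙ β ^ j) ∙ β ^ (k ∸ j) ≈⟨ assoc _ _ _ ⟩
    q ^ j ∙ (β ^ j ∙ β ^ (k ∸ j)) ≈⟨ ∙-congˡ (sym (×-homo-+ β j (k ∸ j))) ⟩
    q ^ j ∙ β ^ (j + (k ∸ j))     ≡⟨ ≡.cong (λ n → q ^ j ∙ β ^ n) (m+[n∸m]≡n j≤k) ⟩
    q ^ j ∙ β ^ k                 ∎

  cancelˡ-invertible : ∀ {a x y} → RightInvertible ε _∙_ a → a ∙ x ≈ a ∙ y → x ≈ y
  cancelˡ-invertible {a} {x} {y} (a⁻¹ , aa⁻¹≈ε) ax≈ay = begin
    x              ≈⟨ sym (cancelˡ a⁻¹a≈ε x) ⟩
    a⁻¹ ∙ (a ∙ x)  ≈⟨ ∙-congˡ ax≈ay ⟩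
    a⁻¹ ∙ (a ∙ y)  ≈⟨ cancelˡ a⁻¹a≈ε y ⟩
    y              ∎
    where a⁻¹a≈ε = trans (comm a⁻¹ a) aa⁻¹≈ε

  invertible-∙ : ∀ {a b} → RightInvertible ε _∙_ a → RightInvertible ε _∙_ b →
                 RightInvertible ε _∙_ (a ∙ b)
  invertible-∙ {a} {b} (a⁻¹ , aa⁻¹≈ε) (b⁻¹ , bb⁻¹≈ε) =
    a⁻¹ ∙ b⁻¹ , trans (interchange a b a⁻¹ b⁻¹) (trans (∙-cong aa⁻¹≈ε bb⁻¹≈ε) (identityʳ ε))

  ^-invertible-≤ : ∀ {x m n} → RightInvertible ε _∙_ (x ^ n) → m ≤ n →
                   RightInvertible ε _∙_ (x ^ m)
  ^-invertible-≤ {x} {m} {n} (y , xⁿy≈ε) m≤n = x ^ (n ∸ m) ∙ y , (begin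
    x ^ m ∙ (x ^ (n ∸ m) ∙ y)  ≈⟨ sym (assoc _ _ _) ⟩
    (x ^ m ∙ x ^ (n ∸ m)) ∙ y  ≈⟨ ∙-congʳ (sym (×-homo-+ x m (n ∸ m))) ⟩
    x ^ (m + (n ∸ m)) ∙ y      ≡⟨ ≡.cong (λ k → x ^ k ∙ y) (m+[n∸m]≡n m≤n) ⟩
    x ^ n ∙ y                  ≈⟨ xⁿy≈ε ⟩
    ε                          ∎)

  module Order {x : Carrier} {N : ℕ} (xᴺ≈ε : x ^ N ≈ ε)
               (N-minimal : ∀ m → 1 ≤ m → x ^ m ≈ ε → N ≤ m) where

    ^-invertible : ∀ {r} → r ≤ N → RightInvertible ε _∙_ (x ^ r)
    ^-invertible = ^-invertible-≤ (ε , trans (identityʳ _) xᴺ≈ε)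

    ^-injective-≤ : ∀ {r r'} → r' < N → r ≤ r' → x ^ r ≈ x ^ r' → r ≡ r'
    ^-injective-≤ {r} r'<N r≤r' xʳ≈xʳ' with m≤n⇒∃[o]m+o≡n r≤r'
    ... | zero  , ≡.refl = ≡.sym (+-identityʳ r)
    ... | suc d , ≡.refl =
      contradiction (N-minimal (suc d) (s≤s z≤n) xᵈ≈ε) (<⇒≱ (≤-<-trans (m≤n+m (suc d) r) r'<N))
      where
      xᵈ≈ε : x ^ suc d ≈ ε
      xᵈ≈ε = cancelˡ-invertible (^-invertible (≤-trans (m≤m+n r (suc d)) (<⇒≤ r'<N))) (begin
        x ^ r ∙ x ^ suc d  ≈⟨ sym (×-homo-+ x r (suc d)) ⟩
        x ^ (r + suc d)    ≈⟨ sym xʳ≈xʳ' ⟩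
        x ^ r              ≈⟨ sym (identityʳ _) ⟩
        x ^ r ∙ ε          ∎)

    ^-injective-< : ∀ {r r'} → r < N → r' < N → x ^ r ≈ x ^ r' → r ≡ r'
    ^-injective-< {r} {r'} r<N r'<N xʳ≈xʳ' with ≤-total r r'
    ... | inj₁ r≤r' = ^-injective-≤ r'<N r≤r' xʳ≈xʳ'
    ... | inj₂ r'≤r = ≡.sym (^-injective-≤ r<N r'≤r (sym xʳ≈xʳ'))

module ExponentRelations {c ℓ} (M : CommutativeMonoid c ℓ) (q β : CommutativeMonoid.Carrier M) where

  open CommutativeMonoid M
  open CommutativeMonoidPowers M
  open import Algebra.Definitions _≈_ using (RightInvertible)
  open import Algebra.Properties.CommutativeSemigroup commutativeSemigroup
    using (interchange; x∙yz≈y∙xz)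
  open import Algebra.Properties.CommutativeMonoid.Mult M using (×-homo-+)
  open import Relation.Binary.Reasoning.Setoid setoid

  -- A record, not a bare _≈_, so that j and k can be inferred from a proof.
  record Relation (j k : ℕ) : Set ℓ where
    constructor relation
    field
      monomial≈ε : q ^ j ∙ β ^ k ≈ ε

  monomial-homo-+ : ∀ j j' k k' → q ^ (j + j') ∙ β ^ (k + k') ≈ (q ^ j ∙ β ^ k) ∙ (q ^ j' ∙ β ^ k')
  monomial-homo-+ j j' k k' = begin
    q ^ (j + j') ∙ β ^ (k + k')          ≈⟨ ∙-cong (×-homo-+ q j j') (×-homo-+ β k k') ⟩
    (q ^ j ∙ q ^ j') ∙ (β ^ k ∙ β ^ k')  ≈⟨ interchange _ _ _ _ ⟩
    (q ^ j ∙ β ^ k) ∙ (q ^ j' ∙ β ^ k')  ∎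

  relation-+ : ∀ {j j' k k'} → Relation j k → Relation j' k' → Relation (j + j') (k + k')
  relation-+ {j} {j'} {k} {k'} (relation rel) (relation rel') = relation (begin
    q ^ (j + j') ∙ β ^ (k + k')          ≈⟨ monomial-homo-+ j j' k k' ⟩
    (q ^ j ∙ β ^ k) ∙ (q ^ j' ∙ β ^ k')  ≈⟨ ∙-cong rel rel' ⟩
    ε ∙ ε                                ≈⟨ identityʳ ε ⟩
    ε                                    ∎)

  relation-∸ : ∀ {j j' k k'} → Relation j' k' → Relation (j + j') (k + k') → Relation j k
  relation-∸ {j} {j'} {k} {k'} (relation rel') (relation rel) = relation (begin
    q ^ j ∙ β ^ k                        ≈⟨ sym (identityʳ _) ⟩
    (q ^ j ∙ β ^ k) ∙ ε                  ≈⟨ ∙-congˡ (sym rel') ⟩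
    (q ^ j ∙ β ^ k) ∙ (q ^ j' ∙ β ^ k')  ≈⟨ sym (monomial-homo-+ j j' k k') ⟩
    q ^ (j + j') ∙ β ^ (k + k')          ≈⟨ rel ⟩
    ε                                    ∎)

  module MinimalRelation (N : ℕ) .{{_ : NonZero N}}
    (qᴺ≈ε : q ^ N ≈ ε) (N-minimal : ∀ m → 1 ≤ m → q ^ m ≈ ε → N ≤ m)
    (kmin j0 : ℕ) (j0-relation : Relation j0 kmin)
    (kmin-minimal : ∀ {j k} → 1 ≤ k → j ≤ k → Relation j k → kmin ≤ k) where

    open Order qᴺ≈ε N-minimal

    relation-mod : ∀ {j k} → Relation j k → Relation (j % N) k
    relation-mod {j} (relation rel) = relation (trans (∙-congʳ (sym (^-mod qᴺ≈ε j))) rel)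

    N+j0-relation : Relation (N + j0) kmin
    N+j0-relation = relation-+ (relation (trans (identityʳ _) qᴺ≈ε)) j0-relation

    no-short-relation : N + j0 ≤ kmin → ∀ {u e} → 1 ≤ e → e < kmin → ¬ Relation u e
    no-short-relation N+j0≤kmin {u} {e} 1≤e e<kmin rel = reduced (m%n<n u N) (relation-mod rel)
      where
      reduced : ∀ {u} → u < N → ¬ Relation u e
      reduced {u} u<N rel with u ≤? e
      ... | yes u≤e = <⇒≱ e<kmin (kmin-minimal 1≤e u≤e rel)
      ... | no  u≰e = <⇒≱ (∸-monoʳ-< 1≤e (<⇒≤ e<kmin))
                        (kmin-minimal (m<n⇒0<n∸m e<kmin) shorter (relation-∸ rel quotient))
        where
        u≤N+j0 : u ≤ N + j0
        u≤N+j0 = ≤-trans (<⇒≤ u<N) (m≤m+n N j0)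
        quotient : Relation (N + j0 ∸ u + u) (kmin ∸ e + e)
        quotient = ≡.subst₂ Relation (≡.sym (m∸n+n≡m u≤N+j0)) (≡.sym (m∸n+n≡m (<⇒≤ e<kmin)))
                     N+j0-relation
        shorter : N + j0 ∸ u ≤ kmin ∸ e
        shorter = ∸-mono N+j0≤kmin (<⇒≤ (≰⇒> u≰e))

    β^-invertible : ∀ {s} → s ≤ kmin → RightInvertible ε _∙_ (β ^ s)
    β^-invertible = ^-invertible-≤ (q ^ j0 , trans (comm _ _) (Relation.monomial≈ε j0-relation))

    exponents-injective-≤ : N + j0 ≤ kmin → ∀ {r r' s s'} → r < N → r' < N → s ≤ s' → s' < kmin →
                            q ^ r ∙ β ^ s ≈ q ^ r' ∙ β ^ s' → s ≡ s' × r ≡ r'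
    exponents-injective-≤ N+j0≤kmin {r} {r'} {s} r<N r'<N s≤s' s'<kmin eq
      with e , ≡.refl ← m≤n⇒∃[o]m+o≡n s≤s' = shift-trivial e s'<kmin shifted
      where
      shifted : q ^ r ≈ q ^ r' ∙ β ^ e
      shifted = cancelˡ-invertible (β^-invertible (≤-trans (m≤m+n s e) (<⇒≤ s'<kmin))) (begin
        β ^ s ∙ q ^ r              ≈⟨ comm _ _ ⟩
        q ^ r ∙ β ^ s              ≈⟨ eq ⟩
        q ^ r' ∙ β ^ (s + e)       ≈⟨ ∙-congˡ (×-homo-+ β s e) ⟩
        q ^ r' ∙ (β ^ s ∙ β ^ e)   ≈⟨ x∙yz≈y∙xz _ _ _ ⟩
        β ^ s ∙ (q ^ r' ∙ β ^ e)   ∎)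
      shift-trivial : ∀ e → s + e < kmin → q ^ r ≈ q ^ r' ∙ β ^ e → s ≡ s + e × r ≡ r'
      shift-trivial zero _ shifted =
        ≡.sym (+-identityʳ s) , ^-injective-< r<N r'<N (trans shifted (identityʳ _))
      shift-trivial (suc e) s+e<kmin shifted = contradiction (relation (begin
        q ^ (N ∸ r + r') ∙ β ^ suc e        ≈⟨ ∙-congʳ (×-homo-+ q (N ∸ r) r') ⟩
        (q ^ (N ∸ r) ∙ q ^ r') ∙ β ^ suc e  ≈⟨ assoc _ _ _ ⟩
        q ^ (N ∸ r) ∙ (q ^ r' ∙ β ^ suc e)  ≈⟨ ∙-congˡ (sym shifted) ⟩
        q ^ (N ∸ r) ∙ q ^ r                 ≈⟨ sym (×-homo-+ q (N ∸ r) r) ⟩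
        q ^ (N ∸ r + r)                     ≡⟨ ≡.cong (q ^_) (m∸n+n≡m (<⇒≤ r<N)) ⟩
        q ^ N                               ≈⟨ qᴺ≈ε ⟩
        ε                                   ∎))
        (no-short-relation N+j0≤kmin {u = N ∸ r + r'} (s≤s z≤n)
          (≤-<-trans (m≤n+m (suc e) s) s+e<kmin))

    grid : Fin kmin × Fin N → Carrier
    grid (s , r) = q ^ toℕ r ∙ β ^ toℕ s

    grid-injective : N + j0 ≤ kmin → ∀ {x y} → grid x ≈ grid y → x ≡ y
    grid-injective N+j0≤kmin {s , r} {s' , r'} eq = ×-≡,≡→≡ (map toℕ-injective toℕ-injective exponents-≡)
      where
      exponents-≡ : toℕ s ≡ toℕ s' × toℕ r ≡ toℕ r'
      exponents-≡ with ≤-total (toℕ s) (toℕ s')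
      ... | inj₁ s≤s' = exponents-injective-≤ N+j0≤kmin (toℕ<n r) (toℕ<n r') s≤s' (toℕ<n s') eq
      ... | inj₂ s'≤s = map ≡.sym ≡.sym
                          (exponents-injective-≤ N+j0≤kmin (toℕ<n r') (toℕ<n r) s'≤s (toℕ<n s) (sym eq))

    grid-invertible : ∀ x → RightInvertible ε _∙_ (grid x)
    grid-invertible (s , r) = invertible-∙ (^-invertible (<⇒≤ (toℕ<n r))) (β^-invertible (<⇒≤ (toℕ<n s)))

    relation-unique : kmin < N + j0 → ∀ {j} → j0 ≤ j → j ≤ kmin → Relation j kmin → j ≡ j0
    relation-unique kmin<N+j0 {j} j0≤j j≤kmin rel with d , ≡.refl ← m≤n⇒∃[o]m+o≡n j0≤j =
      ≡.trans (≡.cong (λ i → j0 + i) (^-injective-< d<N (>-nonZero⁻¹ N) qᵈ≈ε)) (+-identityʳ j0)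
      where
      d<N : d < N
      d<N = +-cancelˡ-< j0 d N (≤-<-trans j≤kmin (≡.subst (kmin <_) (+-comm N j0) kmin<N+j0))
      qᵈ≈ε : q ^ d ≈ q ^ 0
      qᵈ≈ε = trans (sym (identityʳ _)) (Relation.monomial≈ε
               (relation-∸ {k = 0} j0-relation (≡.subst (λ i → Relation i kmin) (+-comm j0 d) rel)))

open ≡ using (refl; sym; trans; cong; cong₂; isEquivalence; module ≡-Reasoning)

[m%n*o]%n≡[m*o]%n : ∀ m o n .{{_ : NonZero n}} → (m % n * o) % n ≡ (m * o) % n
[m%n*o]%n≡[m*o]%n m o n = begin
  (m % n * o) % n            ≡⟨ %-distribˡ-* (m % n) o n ⟩
  (m % n % n * (o % n)) % n  ≡⟨ cong (λ t → (t * (o % n)) % n) (m%n%n≡m%n m n) ⟩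
  (m % n * (o % n)) % n      ≡⟨ %-distribˡ-* m o n ⟨
  (m * o) % n                ∎
  where open ≡-Reasoning

remQuot-injective : ∀ {m} n → Injective _≡_ _≡_ (remQuot {m} n)
remQuot-injective {m} n {i} {j} eq =
  trans (sym (combine-remQuot {m} n i)) (trans (cong (uncurry combine) eq) (combine-remQuot {m} n j))

module ModularMultiplication (p : ℕ) .{{_ : NonZero p}} where

  open import Algebra.Definitions {A = Fin p} _≡_ using (RightInvertible)

  infixl 7 _·_
  _·_ : Fin p → Fin p → Fin p
  _·_ = _*F_ p

  [0] [1] : Fin p
  [0] = [_] p 0
  [1] = [_] p 1

  toℕ-[] : ∀ n → toℕ ([_] p n) ≡ n % p
  toℕ-[] n = toℕ-fromℕ< (m%n<n n p)

  toℕ-· : ∀ x y → toℕ (x · y) ≡ (toℕ x * toℕ y) % p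
  toℕ-· x y = toℕ-fromℕ< _

  toℕ-·-· : ∀ x y z → toℕ (x · y · z) ≡ (toℕ x * toℕ y * toℕ z) % p
  toℕ-·-· x y z = trans (toℕ-· (x · y) z)
    (trans (cong (λ t → (t * toℕ z) % p) (toℕ-· x y)) ([m%n*o]%n≡[m*o]%n _ (toℕ z) p))

  ·-comm : ∀ x y → x · y ≡ y · x
  ·-comm x y = cong (_mod p) (*-comm (toℕ x) (toℕ y))

  ·-assoc : ∀ x y z → x · y · z ≡ x · (y · z)
  ·-assoc x y z = toℕ-injective (begin
    toℕ (x · y · z)                  ≡⟨ toℕ-·-· x y z ⟩
    (toℕ x * toℕ y * toℕ z) % p      ≡⟨ cong (_% p) (*-assoc (toℕ x) (toℕ y) (toℕ z)) ⟩
    (toℕ x * (toℕ y * toℕ z)) % p    ≡⟨ cong (_% p) (*-comm (toℕ x) (toℕ y * toℕ z)) ⟩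
    (toℕ y * toℕ z * toℕ x) % p      ≡⟨ toℕ-·-· y z x ⟨
    toℕ (y · z · x)                  ≡⟨ cong toℕ (·-comm (y · z) x) ⟩
    toℕ (x · (y · z))                ∎)
    where open ≡-Reasoning

  ·-identityˡ : ∀ x → [1] · x ≡ x
  ·-identityˡ x = toℕ-injective (begin
    toℕ ([1] · x)           ≡⟨ toℕ-· [1] x ⟩
    (toℕ [1] * toℕ x) % p   ≡⟨ cong (λ t → (t * toℕ x) % p) (toℕ-[] 1) ⟩
    (1 % p * toℕ x) % p     ≡⟨ [m%n*o]%n≡[m*o]%n 1 (toℕ x) p ⟩
    (1 * toℕ x) % p         ≡⟨ cong (_% p) (*-identityˡ (toℕ x)) ⟩
    toℕ x % p               ≡⟨ m<n⇒m%n≡m (toℕ<n x) ⟩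
    toℕ x                   ∎)
    where open ≡-Reasoning

  ·-zeroˡ : ∀ x → [0] · x ≡ [0]
  ·-zeroˡ x = toℕ-injective (begin
    toℕ ([0] · x)           ≡⟨ toℕ-· [0] x ⟩
    (toℕ [0] * toℕ x) % p   ≡⟨ cong (λ t → (t * toℕ x) % p) (toℕ-[] 0) ⟩
    (0 % p * toℕ x) % p     ≡⟨ [m%n*o]%n≡[m*o]%n 0 (toℕ x) p ⟩
    0 % p                   ≡⟨ toℕ-[] 0 ⟨
    toℕ [0]                 ∎)
    where open ≡-Reasoning

  [1]≢[0] : 2 ≤ p → [1] ≢ [0]
  [1]≢[0] 2≤p [1]≡[0] = 1+n≢0 (begin
    1          ≡⟨ m<n⇒m%n≡m 2≤p ⟨
    1 % p      ≡⟨ toℕ-[] 1 ⟨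
    toℕ [1]    ≡⟨ cong toℕ [1]≡[0] ⟩
    toℕ [0]    ≡⟨ toℕ-[] 0 ⟩
    0 % p      ≡⟨ m<n⇒m%n≡m (<-trans z<s 2≤p) ⟩
    0          ∎)
    where open ≡-Reasoning

  ·-commutativeMonoid : CommutativeMonoid 0ℓ 0ℓ
  ·-commutativeMonoid = record
    { Carrier = Fin p
    ; _≈_ = _≡_
    ; _∙_ = _·_
    ; ε = [1]
    ; isCommutativeMonoid = isCommutativeMonoidˡ record
      { isSemigroup = record
        { isMagma = record { isEquivalence = isEquivalence ; ∙-cong = cong₂ _·_ }
        ; assoc   = ·-assoc
        }
      ; identityˡ = ·-identityˡ
      ; comm      = ·-comm
      }
    }

  open CommutativeMonoidPowers ·-commutativeMonoid using (_^_; ^-rebase)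

  ^F≡^ : ∀ x n → _^F_ p x n ≡ x ^ n
  ^F≡^ x zero    = refl
  ^F≡^ x (suc n) = cong (x ·_) (^F≡^ x n)

  ^F-rebase : ∀ {α β q j k} → q · β ≡ α → j ≤ k →
              _^F_ p α j · _^F_ p β (k ∸ j) ≡ q ^ j · β ^ k
  ^F-rebase {α} {β} {j = j} {k} qβ≡α j≤k =
    trans (cong₂ _·_ (^F≡^ α j) (^F≡^ β (k ∸ j))) (^-rebase qβ≡α j≤k)

  invertible⇒≢[0] : 2 ≤ p → ∀ {x} → RightInvertible [1] _·_ x → x ≢ [0]
  invertible⇒≢[0] 2≤p (y , xy≡[1]) refl = [1]≢[0] 2≤p (trans (sym xy≡[1]) (·-zeroˡ y))

  units-bound : 2 ≤ p → ∀ {m} (f : Fin m → Fin p) → Injective _≡_ _≡_ f →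
                (∀ i → RightInvertible [1] _·_ (f i)) → m < p
  units-bound 2≤p {m} f f-injective f-invertible = injective⇒≤ f₀-injective
    where
    f₀ : Fin (suc m) → Fin p
    f₀ zero    = [0]
    f₀ (suc i) = f i
    f₀-injective : Injective _≡_ _≡_ f₀
    f₀-injective {zero}  {zero}  _       = refl
    f₀-injective {zero}  {suc j} [0]≡fj  =
      contradiction (sym [0]≡fj) (invertible⇒≢[0] 2≤p (f-invertible j))
    f₀-injective {suc i} {zero}  fi≡[0]  =
      contradiction fi≡[0] (invertible⇒≢[0] 2≤p (f-invertible i))
    f₀-injective {suc i} {suc j} fi≡fj   = cong suc (f-injective fi≡fj)

lemma4p4 : (p : ℕ) .{{_ : NonZero p}} → Prime p → 5 ≤ p →
    (α β γ : Fin p) → α ≢ β → α ≢ γ → β ≢ γ →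
    IsRootCubic p α → IsRootCubic p β → IsRootCubic p γ →
    (a : ℤ → Fin p) → CompletePadovan p a →
    _+F_ p (_+F_ p (_*F_ p (_^F_ p γ 2) (a (+ 1))) (_*F_ p γ (a (+ 2)))) ([_] p 1) ≡ [_] p 0 →
    (q : Fin p) → _*F_ p q β ≡ α →
    (N : ℕ) → IsMultOrder p q N →
    (kmin : ℕ) → IsKmin p α β kmin →
    (j0 : ℕ) → IsMinI p α β kmin j0 →
    p ∸ 1 < kmin * N →
    (kmin < N + j0) × (∀ j → InI p α β kmin j → j ≡ j0)
lemma4p4 p _ 5≤p α β _ _ _ _ _ _ _ _ _ _ q qβ≡α N (1≤N , qᴺ≡[1] , N-minimal)
         kmin (_ , _ , kmin-minimal) j0 (j0∈I , j0-minimal) p∸1<kmin*N =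
  kmin<N+j0 , λ j j∈I → relation-unique kmin<N+j0 (j0-minimal j j∈I) (proj₁ j∈I) (I⇒relation j∈I)
  where
  open ModularMultiplication p
  open ExponentRelations ·-commutativeMonoid q β

  instance
    N≢0 : NonZero N
    N≢0 = >-nonZero 1≤N

  I⇒relation : ∀ {k j} → InI p α β k j → Relation j k
  I⇒relation (j≤k , αʲβᵏ⁻ʲ≡[1]) = relation (trans (sym (^F-rebase qβ≡α j≤k)) αʲβᵏ⁻ʲ≡[1])

  open MinimalRelation N
    (trans (sym (^F≡^ q N)) qᴺ≡[1])
    (λ m 1≤m qᵐ≡[1] → N-minimal m 1≤m (trans (^F≡^ q m) qᵐ≡[1]))
    kmin j0 (I⇒relation j0∈I)
    (λ 1≤k j≤k (relation qʲβᵏ≡[1]) → kmin-minimal _ 1≤k (_ , j≤k , trans (^F-rebase qβ≡α j≤k) qʲβᵏ≡[1]))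

  kmin<N+j0 : kmin < N + j0
  kmin<N+j0 = ≰⇒> λ N+j0≤kmin → <⇒≱ p∸1<kmin*N (<⇒≤pred
    (units-bound (≤-trans (s≤s (s≤s z≤n)) 5≤p) (grid ∘ remQuot N)
      (remQuot-injective N ∘ grid-injective N+j0≤kmin) (grid-invertible ∘ remQuot N)))
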